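{- Let $\mathcal{M}$ and $\mathcal{A}$ be two disjoint antichains in $2^{[n]}$, $[n]=\{1,\ldots,n\}$, with $[n]\notin\mathcal{M}$. Suppose that for every $A\in\mathcal{A}$ there is a unique $f(A)\in\mathcal{M}$ with $A\subset f(A)$. Then $$\sum_{M\in\mathcal{M}}\binom{n}{|M|}^{ -1}+\sum_{A\in\mathcal{A}}\binom{n}{|A|}^{ -1}\left(1-\frac{1}{n-|A|}\right)\leq 1,$$ with equality only when, for each $A\in\mathcal{A}$, either $|f(A)|=n-1$ or $|f(A)|=|A|+1$.
   Context: An antichain is a family of sets no two distinct members of which are comparable under inclusion. -}

module Defs where

open import Data.Nat using (ℕ; zero; suc)
open import Data.Integer using (+_)
open import Data.Rational using (ℚ; 0ℚ; _+_; _/_)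
open import Data.List using (List; []; _∷_)
open import Data.Fin.Subset using (Subset; _⊆_)
open import Data.List.Membership.Propositional using (_∈_)
open import Relation.Binary.PropositionalEquality using (_≢_)
open import Relation.Nullary using (¬_)

-- reciprocal of a natural number as a rational; 1/0 is set to 0
-- (never used at 0 under the hypotheses of lemma3)
inv : ℕ → ℚ
inv zero = 0ℚ
inv (suc k) = (+ 1) / (suc k)

sumℚ : List ℚ → ℚ
sumℚ [] = 0ℚ
sumℚ (x ∷ xs) = x + sumℚ xs

IsAntichain : ∀ {n} → List (Subset n) → Set
IsAntichain {n} F = ∀ (X Y : Subset n) → X ∈ F → Y ∈ F → X ≢ Y → ¬ (X ⊆ Y)

{-# OPTIONS --safe #-}
module Submission where

-- Count the pairs (C, X) of a maximal chain C in 2^[n] and a member X ∈ ℳ ∪ 𝒜 lying on C: there are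
-- ∑ |X|! (n - |X|)! of them. A maximal chain meets each antichain at most once, and if it meets both
-- A ∈ 𝒜 and M ∈ ℳ then A ⊂ M (M ⊆ A ⊂ f(A) is impossible in the antichain ℳ), so M = f(A). Hence
-- discarding the |A|! (|f(A)| - |A|)! (n - |f(A)|)! chains through A and f(A), for every A, leaves at
-- most n! pairs. As (m - a)! (n - m)! ≤ (n - a - 1)! for a < m < n, strictly unless m = a + 1 or
-- m = n - 1, dividing by n! gives the inequality and its equality case. The count is made for the
-- chains from ∅ to every p ⊆ [n] at once, by induction on |p| over the last element added to the chain.

module Chains where

  open import Defs using (IsAntichain)
  open import Algebra.Properties.CommutativeSemigroup using (interchange)
  open import Data.Bool using () renaming (_≟_ to _≟ᵇ_)
  open import Data.Fin using (Fin; zero; suc)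
  open import Data.Fin.Subset using (Subset; inside; outside; ∣_∣; _⊆_; _⊂_; _-_; ⊤)
    renaming (_∈_ to _∈ₛ_; _∉_ to _∉ₛ_)
  open import Data.Fin.Subset.Properties
    using (_⊆?_; ⊆-refl; ⊆⊤; ∣⊤∣≡n; drop-∷-⊆; drop-there; s⊂s; out⊂in; p⊂q⇒p⊆q; ⊆-⊂-trans; ⊂-irref;
           p⊆q⇒∣p∣≤∣q∣; p⊂q⇒∣p∣<∣q∣; p─⊥≡p; p─q⊆p; x∈p∧x≢y⇒x∈p-y; x∈p⇒∣p-x∣<∣p∣)
  open import Data.List using (List; []; _∷_)
  open import Data.List.Membership.Propositional using (_∈_; _∉_)
  open import Data.List.Relation.Unary.All as All using ()
  open import Data.List.Relation.Unary.AllPairs using (_∷_)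
  open import Data.List.Relation.Unary.Any using (here; there)
  open import Data.List.Relation.Unary.Unique.Propositional using (Unique)
  open import Data.Nat using (ℕ; zero; suc; pred; _+_; _*_; _∸_; _≤_; _<_; _!; z≤n; z<s; s≤s; NonZero; >-nonZero)
  open import Data.Nat.Combinatorics using (_C_; nCk≡n!/k![n-k]!; k![n∸k]!∣n!)
  open import Data.Nat.DivMod using (m/n*n≡m)
  open import Data.Nat.Induction using (<-wellFounded)
  open import Data.Nat.Properties
  open import Data.Nat.Solver using (module +-*-Solver)
  open import Data.Product using (Σ; _,_; _×_; ∃-syntax; proj₁; proj₂)
  open import Data.Sum using (_⊎_; inj₁; inj₂)
  open import Data.Vec using ([]; _∷_; here; there)
  open import Data.Vec.Properties using (≡-dec)
  open import Function using (_∘_)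
  open import Induction.WellFounded using (Acc; acc)
  open import Relation.Binary.PropositionalEquality
  open import Relation.Nullary using (¬_; Dec; yes; no; contradiction)
  open import Relation.Nullary.Decidable using (_⊎-dec_)

  private
    +-interchange : ∀ a b c d → a + b + (c + d) ≡ a + c + (b + d)
    +-interchange = interchange +-commutativeSemigroup

  module _ {a} {A : Set a} where

    ∑ : List A → (A → ℕ) → ℕ
    ∑ []       f = 0
    ∑ (x ∷ xs) f = f x + ∑ xs f

    ∑-cong : ∀ xs {f g : A → ℕ} → (∀ {x} → x ∈ xs → f x ≡ g x) → ∑ xs f ≡ ∑ xs g
    ∑-cong []       f≡g = refl
    ∑-cong (x ∷ xs) f≡g = cong₂ _+_ (f≡g (here refl)) (∑-cong xs (f≡g ∘ there))

    ∑-mono : ∀ xs {f g : A → ℕ} → (∀ {x} → x ∈ xs → f x ≤ g x) → ∑ xs f ≤ ∑ xs g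
    ∑-mono []       f≤g = z≤n
    ∑-mono (x ∷ xs) f≤g = +-mono-≤ (f≤g (here refl)) (∑-mono xs (f≤g ∘ there))

    ∑-mono-< : ∀ xs {f g : A → ℕ} → (∀ {x} → x ∈ xs → f x ≤ g x) →
               ∀ {y} → y ∈ xs → f y < g y → ∑ xs f < ∑ xs g
    ∑-mono-< (x ∷ xs) f≤g (here refl) fy<gy = +-mono-<-≤ fy<gy (∑-mono xs (f≤g ∘ there))
    ∑-mono-< (x ∷ xs) f≤g (there y∈xs) fy<gy =
      +-mono-≤-< (f≤g (here refl)) (∑-mono-< xs (f≤g ∘ there) y∈xs fy<gy)

    ∑-distrib-+ : ∀ xs (f g : A → ℕ) → ∑ xs (λ x → f x + g x) ≡ ∑ xs f + ∑ xs g
    ∑-distrib-+ []       f g = refl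
    ∑-distrib-+ (x ∷ xs) f g =
      trans (cong (f x + g x +_) (∑-distrib-+ xs f g)) (+-interchange (f x) (g x) _ _)

    ∑-zero : ∀ xs {f : A → ℕ} → (∀ {x} → x ∈ xs → f x ≡ 0) → ∑ xs f ≡ 0
    ∑-zero []       f≡0 = refl
    ∑-zero (x ∷ xs) f≡0 = cong₂ _+_ (f≡0 (here refl)) (∑-zero xs (f≡0 ∘ there))

    ≤-∑ : ∀ xs (f : A → ℕ) {y} → y ∈ xs → f y ≤ ∑ xs f
    ≤-∑ (x ∷ xs) f (here refl)  = m≤m+n (f x) _
    ≤-∑ (x ∷ xs) f (there y∈xs) = ≤-trans (≤-∑ xs f y∈xs) (m≤n+m _ (f x))

    ∑-single : ∀ {xs} (f : A → ℕ) → Unique xs → ∀ {y} → y ∈ xs →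
               (∀ {x} → x ∈ xs → x ≢ y → f x ≡ 0) → ∑ xs f ≡ f y
    ∑-single {x ∷ xs} f (x∉xs ∷ _) (here refl) others =
      trans (cong (f x +_) (∑-zero xs (λ x′∈xs → others (there x′∈xs) (≢-sym (All.lookup x∉xs x′∈xs)))))
            (+-identityʳ (f x))
    ∑-single {x ∷ xs} f (x∉xs ∷ unique) (there y∈xs) others =
      trans (cong (_+ ∑ xs f) (others (here refl) (All.lookup x∉xs y∈xs)))
            (∑-single f unique y∈xs (others ∘ there))

  module _ {a} {A : Set a} {xs : List A} {f g : A → ℕ} (g≤f : ∀ {x} → x ∈ xs → g x ≤ f x) where

    ∑-cancel-≤ : ∀ {m n} → m + ∑ xs f ≤ n + ∑ xs g → m ≤ n
    ∑-cancel-≤ {m} {n} le = +-cancelʳ-≤ (∑ xs f) m n (≤-trans le (+-monoʳ-≤ n (∑-mono xs g≤f)))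

    ∑-cancel-< : ∀ {y} → y ∈ xs → g y < f y → ∀ {m n} → m + ∑ xs f ≤ n + ∑ xs g → m < n
    ∑-cancel-< y∈xs gy<fy {m} {n} le =
      +-cancelʳ-< (∑ xs f) m n (≤-<-trans le (+-monoʳ-< n (∑-mono-< xs g≤f y∈xs gy<fy)))

  private
    variable
      n : ℕ

  ∑ₛ : Subset n → (Fin n → ℕ) → ℕ
  ∑ₛ []            f = 0
  ∑ₛ (inside  ∷ p) f = f zero + ∑ₛ p (f ∘ suc)
  ∑ₛ (outside ∷ p) f = ∑ₛ p (f ∘ suc)

  ∑ₛ-mono : ∀ (p : Subset n) {f g} → (∀ {x} → x ∈ₛ p → f x ≤ g x) → ∑ₛ p f ≤ ∑ₛ p g
  ∑ₛ-mono []            f≤g = z≤n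
  ∑ₛ-mono (inside  ∷ p) f≤g = +-mono-≤ (f≤g here) (∑ₛ-mono p (f≤g ∘ there))
  ∑ₛ-mono (outside ∷ p) f≤g = ∑ₛ-mono p (f≤g ∘ there)

  ∑ₛ-cong : ∀ (p : Subset n) {f g} → (∀ {x} → x ∈ₛ p → f x ≡ g x) → ∑ₛ p f ≡ ∑ₛ p g
  ∑ₛ-cong p f≡g = ≤-antisym (∑ₛ-mono p (≤-reflexive ∘ f≡g)) (∑ₛ-mono p (≤-reflexive ∘ sym ∘ f≡g))

  ∑ₛ-distrib-+ : ∀ (p : Subset n) f g → ∑ₛ p (λ x → f x + g x) ≡ ∑ₛ p f + ∑ₛ p g
  ∑ₛ-distrib-+ []            f g = refl
  ∑ₛ-distrib-+ (inside  ∷ p) f g =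
    trans (cong (f zero + g zero +_) (∑ₛ-distrib-+ p (f ∘ suc) (g ∘ suc))) (+-interchange (f zero) (g zero) _ _)
  ∑ₛ-distrib-+ (outside ∷ p) f g = ∑ₛ-distrib-+ p (f ∘ suc) (g ∘ suc)

  ∑ₛ-distribˡ-* : ∀ (p : Subset n) c f → ∑ₛ p (λ x → c * f x) ≡ c * ∑ₛ p f
  ∑ₛ-distribˡ-* []            c f = sym (*-zeroʳ c)
  ∑ₛ-distribˡ-* (inside  ∷ p) c f =
    trans (cong (c * f zero +_) (∑ₛ-distribˡ-* p c (f ∘ suc))) (sym (*-distribˡ-+ c (f zero) _))
  ∑ₛ-distribˡ-* (outside ∷ p) c f = ∑ₛ-distribˡ-* p c (f ∘ suc)

  ∑ₛ-const : ∀ (p : Subset n) c → ∑ₛ p (λ _ → c) ≡ ∣ p ∣ * c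
  ∑ₛ-const []            c = refl
  ∑ₛ-const (inside  ∷ p) c = cong (c +_) (∑ₛ-const p c)
  ∑ₛ-const (outside ∷ p) c = ∑ₛ-const p c

  ∑ₛ-zero : ∀ (p : Subset n) → ∑ₛ p (λ _ → 0) ≡ 0
  ∑ₛ-zero p = trans (∑ₛ-const p 0) (*-zeroʳ ∣ p ∣)

  ∑ₛ-∑-comm : ∀ {a} {A : Set a} (p : Subset n) xs (F : A → Fin n → ℕ) →
              ∑ₛ p (λ i → ∑ xs λ x → F x i) ≡ ∑ xs λ x → ∑ₛ p (F x)
  ∑ₛ-∑-comm p []       F = ∑ₛ-zero p
  ∑ₛ-∑-comm p (x ∷ xs) F = trans (∑ₛ-distrib-+ p (F x) _) (cong (∑ₛ p (F x) +_) (∑ₛ-∑-comm p xs F))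

  ∑ₛ-const-outside : ∀ {p q : Subset n} {f c} → q ⊆ p →
                     (∀ {x} → x ∈ₛ q → f x ≡ 0) → (∀ {x} → x ∈ₛ p → x ∉ₛ q → f x ≡ c) →
                     ∑ₛ p f ≡ (∣ p ∣ ∸ ∣ q ∣) * c
  ∑ₛ-const-outside {p = []}          {q = []}          q⊆p in-q out-q = refl
  ∑ₛ-const-outside {p = inside  ∷ p} {q = inside  ∷ q} q⊆p in-q out-q =
    cong₂ _+_ (in-q here)
              (∑ₛ-const-outside (drop-∷-⊆ q⊆p) (in-q ∘ there) λ x∈p x∉q → out-q (there x∈p) (x∉q ∘ drop-there))
  ∑ₛ-const-outside {p = inside  ∷ p} {q = outside ∷ q} {f} {c} q⊆p in-q out-q = begin
    f zero + ∑ₛ p (f ∘ suc)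
      ≡⟨ cong₂ _+_ (out-q here λ ())
                   (∑ₛ-const-outside (drop-∷-⊆ q⊆p) (in-q ∘ there) λ x∈p x∉q → out-q (there x∈p) (x∉q ∘ drop-there)) ⟩
    c + (∣ p ∣ ∸ ∣ q ∣) * c
      ≡⟨ cong (_* c) (+-∸-assoc 1 (p⊆q⇒∣p∣≤∣q∣ (drop-∷-⊆ q⊆p))) ⟨
    (suc ∣ p ∣ ∸ ∣ q ∣) * c
      ∎
    where open ≡-Reasoning
  ∑ₛ-const-outside {p = outside ∷ p} {q = outside ∷ q} q⊆p in-q out-q =
    ∑ₛ-const-outside (drop-∷-⊆ q⊆p) (in-q ∘ there) λ x∈p x∉q → out-q (there x∈p) (x∉q ∘ drop-there)
  ∑ₛ-const-outside {p = outside ∷ p} {q = inside  ∷ q} q⊆p in-q out-q with () ← q⊆p here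

  n*pred[n]!≡n! : ∀ n .{{_ : NonZero n}} → n * pred n ! ≡ n !
  n*pred[n]!≡n! (suc n) = refl

  n*pred[n]!≤n! : ∀ n → n * pred n ! ≤ n !
  n*pred[n]!≤n! zero    = z≤n
  n*pred[n]!≤n! (suc n) = ≤-refl

  [m∸l]+[n∸m]≡n∸l : ∀ {l m n} → l ≤ m → m ≤ n → (m ∸ l) + (n ∸ m) ≡ n ∸ l
  [m∸l]+[n∸m]≡n∸l {l} {m} {n} l≤m m≤n = begin
    (m ∸ l) + (n ∸ m)   ≡⟨ +-comm (m ∸ l) (n ∸ m) ⟩
    (n ∸ m) + (m ∸ l)   ≡⟨ +-∸-assoc (n ∸ m) l≤m ⟨
    (n ∸ m) + m ∸ l     ≡⟨ cong (_∸ l) (m∸n+n≡m m≤n) ⟩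
    n ∸ l               ∎
    where open ≡-Reasoning

  x*[1+k]!≡x*k!*k+x*k! : ∀ x k → x * suc k ! ≡ x * k ! * k + x * k !
  x*[1+k]!≡x*k!*k+x*k! x k =
    solve 3 (λ x k k! → x :* ((con 1 :+ k) :* k!) := x :* k! :* k :+ x :* k!) refl x k (k !)
    where open +-*-Solver

  m!*n!≤pred[m+n]! : ∀ m n .{{_ : NonZero m}} .{{_ : NonZero n}} → m ! * n ! ≤ pred (m + n) !
  m!*n!≤pred[m+n]! 1                  n@(suc _) = ≤-reflexive (+-identityʳ (n !))
  m!*n!≤pred[m+n]! (suc m@(suc _))    n@(suc _) = begin
    suc m ! * n !             ≡⟨ *-assoc (suc m) (m !) (n !) ⟩
    suc m * (m ! * n !)       ≤⟨ *-monoʳ-≤ (suc m) (m!*n!≤pred[m+n]! m n) ⟩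
    suc m * pred (m + n) !    ≤⟨ *-monoˡ-≤ (pred (m + n) !) (m<m+n m z<s) ⟩
    (m + n) * pred (m + n) !  ∎
    where open ≤-Reasoning

  m!*n!<pred[m+n]! : ∀ m n → 2 ≤ m → 2 ≤ n → m ! * n ! < pred (m + n) !
  m!*n!<pred[m+n]! 1               _         (s≤s ()) _
  m!*n!<pred[m+n]! (suc m@(suc _)) n@(suc _) _        2≤n = begin-strict
    suc m ! * n !             ≡⟨ *-assoc (suc m) (m !) (n !) ⟩
    suc m * (m ! * n !)       ≤⟨ *-monoʳ-≤ (suc m) (m!*n!≤pred[m+n]! m n) ⟩
    suc m * pred (m + n) !    <⟨ *-monoˡ-< (pred (m + n) !) {{pred (m + n) !≢0}} 2+m≤m+n ⟩
    (m + n) * pred (m + n) !  ∎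
    where
    open ≤-Reasoning
    2+m≤m+n : 2 + m ≤ m + n
    2+m≤m+n = subst (_≤ m + n) (+-comm m 2) (+-monoʳ-≤ m 2≤n)

  nCk*[k!*[n∸k]!]≡n! : ∀ {n k} → k ≤ n → (n C k) * (k ! * (n ∸ k) !) ≡ n !
  nCk*[k!*[n∸k]!]≡n! {n} {k} k≤n = trans (cong (_* (k ! * (n ∸ k) !)) (nCk≡n!/k![n-k]! k≤n))
                                         (m/n*n≡m {{k !* (n ∸ k) !≢0}} (k![n∸k]!∣n! k≤n))

  p⊆q∧p≢q⇒p⊂q : ∀ {p q : Subset n} → p ⊆ q → p ≢ q → p ⊂ q
  p⊆q∧p≢q⇒p⊂q {p = []}          {[]}          _   p≢q = contradiction refl p≢q
  p⊆q∧p≢q⇒p⊂q {p = inside  ∷ p} {inside  ∷ q} p⊆q p≢q =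
    s⊂s (p⊆q∧p≢q⇒p⊂q (drop-∷-⊆ p⊆q) (p≢q ∘ cong (inside ∷_)))
  p⊆q∧p≢q⇒p⊂q {p = outside ∷ p} {outside ∷ q} p⊆q p≢q =
    s⊂s (p⊆q∧p≢q⇒p⊂q (drop-∷-⊆ p⊆q) (p≢q ∘ cong (outside ∷_)))
  p⊆q∧p≢q⇒p⊂q {p = outside ∷ p} {inside  ∷ q} p⊆q _ = out⊂in (drop-∷-⊆ p⊆q)
  p⊆q∧p≢q⇒p⊂q {p = inside  ∷ p} {outside ∷ q} p⊆q _ with () ← p⊆q here

  x∈p⇒suc∣p-x∣≡∣p∣ : ∀ {p : Subset n} {x} → x ∈ₛ p → suc ∣ p - x ∣ ≡ ∣ p ∣
  x∈p⇒suc∣p-x∣≡∣p∣ {p = inside  ∷ p} here        = cong (suc ∘ ∣_∣) (p─⊥≡p p)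
  x∈p⇒suc∣p-x∣≡∣p∣ {p = inside  ∷ p} (there x∈p) = cong suc (x∈p⇒suc∣p-x∣≡∣p∣ x∈p)
  x∈p⇒suc∣p-x∣≡∣p∣ {p = outside ∷ p} (there x∈p) = x∈p⇒suc∣p-x∣≡∣p∣ x∈p

  x∉p-x : ∀ (p : Subset n) x → x ∉ₛ p - x
  x∉p-x (b ∷ p) (suc x) (there x∈p-x) = x∉p-x p x x∈p-x

  p-x⊆p : ∀ (p : Subset n) x → p - x ⊆ p
  p-x⊆p p x = p─q⊆p p _

  q⊆p∧x∉q⇒q⊆p-x : ∀ {p q : Subset n} {x} → q ⊆ p → x ∉ₛ q → q ⊆ p - x
  q⊆p∧x∉q⇒q⊆p-x q⊆p x∉q y∈q = x∈p∧x≢y⇒x∈p-y (q⊆p y∈q) (λ { refl → x∉q y∈q })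

  -- ⋖ is the covering relation: the sets covered by p are the p - x with x ∈ p
  ∑⋖ : Subset n → (Subset n → ℕ) → ℕ
  ∑⋖ p f = ∑ₛ p λ x → f (p - x)

  -- the number of maximal chains q = X₀ ⊂ X₁ ⊂ ⋯ ⊂ Xₖ = p
  chains : Subset n → Subset n → ℕ
  chains q p with q ⊆? p
  ... | yes _ = (∣ p ∣ ∸ ∣ q ∣) !
  ... | no  _ = 0

  chains-⊆ : ∀ {p q : Subset n} → q ⊆ p → chains q p ≡ (∣ p ∣ ∸ ∣ q ∣) !
  chains-⊆ {p = p} {q} q⊆p with q ⊆? p
  ... | yes _   = refl
  ... | no  q⊈p = contradiction (λ {x} → q⊆p {x}) q⊈p

  chains-⊈ : ∀ {p q : Subset n} → ¬ q ⊆ p → chains q p ≡ 0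
  chains-⊈ {p = p} {q} q⊈p with q ⊆? p
  ... | yes q⊆p = contradiction (λ {x} → q⊆p {x}) q⊈p
  ... | no  _   = refl

  chains-refl : ∀ (p : Subset n) → chains p p ≡ 1
  chains-refl p = trans (chains-⊆ {p = p} ⊆-refl) (cong _! (n∸n≡0 ∣ p ∣))

  chains-∑⋖ : ∀ {p q : Subset n} → q ≢ p → ∑⋖ p (chains q) ≡ chains q p
  chains-∑⋖ {p = p} {q} q≢p with q ⊆? p
  ... | no q⊈p = trans (∑ₛ-cong p λ {x} _ → chains-⊈ λ q⊆p-x → q⊈p (p-x⊆p p x ∘ q⊆p-x)) (∑ₛ-zero p)
  ... | yes q⊆p = begin
    ∑⋖ p (chains q)                           ≡⟨ ∑ₛ-const-outside q⊆p removed-from-q removed-outside-q ⟩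
    (∣ p ∣ ∸ ∣ q ∣) * (∣ p ∣ ∸ suc ∣ q ∣) !   ≡⟨ cong (λ k → (∣ p ∣ ∸ ∣ q ∣) * k !) (pred[m∸n]≡m∸[1+n] ∣ p ∣ ∣ q ∣) ⟨
    (∣ p ∣ ∸ ∣ q ∣) * pred (∣ p ∣ ∸ ∣ q ∣) !  ≡⟨ n*pred[n]!≡n! (∣ p ∣ ∸ ∣ q ∣) {{>-nonZero (m<n⇒0<n∸m ∣q∣<∣p∣)}} ⟩
    (∣ p ∣ ∸ ∣ q ∣) !                         ∎
    where
    open ≡-Reasoning
    ∣q∣<∣p∣ : ∣ q ∣ < ∣ p ∣
    ∣q∣<∣p∣ = p⊂q⇒∣p∣<∣q∣ (p⊆q∧p≢q⇒p⊂q q⊆p q≢p)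
    removed-from-q : ∀ {x} → x ∈ₛ q → chains q (p - x) ≡ 0
    removed-from-q x∈q = chains-⊈ λ q⊆p-x → x∉p-x p _ (q⊆p-x x∈q)
    removed-outside-q : ∀ {x} → x ∈ₛ p → x ∉ₛ q → chains q (p - x) ≡ (∣ p ∣ ∸ suc ∣ q ∣) !
    removed-outside-q x∈p x∉q = trans (chains-⊆ (q⊆p∧x∉q⇒q⊆p-x q⊆p x∉q))
                                      (cong (λ k → (k ∸ suc ∣ q ∣) !) (x∈p⇒suc∣p-x∣≡∣p∣ x∈p))

  ∑⋖-∑ : ∀ {a} {A : Set a} xs (w : A → ℕ) (F : A → Subset n → ℕ) {p} →
         (∀ {x} → x ∈ xs → ∑⋖ p (F x) ≡ F x p) →
         ∑⋖ p (λ r → ∑ xs λ x → w x * F x r) ≡ ∑ xs λ x → w x * F x p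
  ∑⋖-∑ xs w F {p} ∑⋖F≡F = begin
    ∑⋖ p (λ r → ∑ xs λ x → w x * F x r)         ≡⟨ ∑ₛ-∑-comm p xs (λ x i → w x * F x (p - i)) ⟩
    (∑ xs λ x → ∑ₛ p λ i → w x * F x (p - i))   ≡⟨ ∑-cong xs (λ {x} _ → ∑ₛ-distribˡ-* p (w x) (λ i → F x (p - i))) ⟩
    (∑ xs λ x → w x * ∑⋖ p (F x))               ≡⟨ ∑-cong xs (λ {x} x∈xs → cong (w x *_) (∑⋖F≡F x∈xs)) ⟩
    (∑ xs λ x → w x * F x p)                     ∎
    where open ≡-Reasoning

  chainsThrough : (Subset n → ℕ) → List (Subset n) → Subset n → ℕ
  chainsThrough w xs p = ∑ xs λ q → w q * chains q p

  module _ (w : Subset n → ℕ) {xs : List (Subset n)} {p : Subset n} where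

    chainsThrough-∑⋖ : p ∉ xs → ∑⋖ p (chainsThrough w xs) ≡ chainsThrough w xs p
    chainsThrough-∑⋖ p∉xs = ∑⋖-∑ xs w chains (λ {q} q∈xs → chains-∑⋖ {p = p} {q} (λ { refl → p∉xs q∈xs }))

    chainsThrough-antichain : Unique xs → IsAntichain xs → p ∈ xs → chainsThrough w xs p ≡ w p
    chainsThrough-antichain unique antichain p∈xs = begin
      chainsThrough w xs p ≡⟨ ∑-single (λ q → w q * chains q p) unique p∈xs others ⟩
      w p * chains p p     ≡⟨ cong (w p *_) (chains-refl p) ⟩
      w p * 1              ≡⟨ *-identityʳ (w p) ⟩
      w p                  ∎
      where
      open ≡-Reasoning
      others : ∀ {q} → q ∈ xs → q ≢ p → w q * chains q p ≡ 0
      others {q} q∈xs q≢p = trans (cong (w q *_) (chains-⊈ (antichain q p q∈xs p∈xs q≢p))) (*-zeroʳ (w q))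

    chainsThrough-⊈ : (∀ {q} → q ∈ xs → ¬ q ⊆ p) → chainsThrough w xs p ≡ 0
    chainsThrough-⊈ q⊈p = ∑-zero xs (λ {q} q∈xs → trans (cong (w q *_) (chains-⊈ (q⊈p q∈xs))) (*-zeroʳ (w q)))

    ≤-chainsThrough : p ∈ xs → w p ≤ chainsThrough w xs p
    ≤-chainsThrough p∈xs = begin
      w p                 ≡⟨ *-identityʳ (w p) ⟨
      w p * 1             ≡⟨ cong (w p *_) (chains-refl p) ⟨
      w p * chains p p    ≤⟨ ≤-∑ xs (λ q → w q * chains q p) p∈xs ⟩
      chainsThrough w xs p ∎
      where open ≤-Reasoning

  chainsThrough-⊤ : ∀ (w : Subset n → ℕ) xs → chainsThrough w xs ⊤ ≡ ∑ xs λ q → w q * (n ∸ ∣ q ∣) !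
  chainsThrough-⊤ {n} w xs = ∑-cong xs λ {q} _ →
    cong (w q *_) (trans (chains-⊆ {p = ⊤} {q} ⊆⊤) (cong (λ m → (m ∸ ∣ q ∣) !) (∣⊤∣≡n n)))

  -- |p| · (|p| - 1)! = |p|!, so the bound passes from the sets covered by p to p itself.
  ≤!+-by-∑⋖-induction : ∀ {ℓ} {B : Subset n → Set ℓ} (B? : ∀ p → Dec (B p)) {f g : Subset n → ℕ} →
                        (∀ p → B p → f p ≤ ∣ p ∣ ! + g p) →
                        (∀ p → ¬ B p → f p ≤ ∑⋖ p f) →
                        (∀ p → ¬ B p → ∑⋖ p g ≤ g p) →
                        ∀ p → f p ≤ ∣ p ∣ ! + g p
  ≤!+-by-∑⋖-induction B? {f} {g} base f-sub g-super p = go p (<-wellFounded ∣ p ∣)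
    where
    go : ∀ p → Acc _<_ ∣ p ∣ → f p ≤ ∣ p ∣ ! + g p
    go p (acc rec) with B? p
    ... | yes Bp = base p Bp
    ... | no ¬Bp = begin
      f p                                       ≤⟨ f-sub p ¬Bp ⟩
      ∑⋖ p f                                    ≤⟨ ∑ₛ-mono p IH ⟩
      ∑ₛ p (λ x → pred ∣ p ∣ ! + g (p - x))     ≡⟨ ∑ₛ-distrib-+ p _ _ ⟩
      ∑ₛ p (λ _ → pred ∣ p ∣ !) + ∑⋖ p g        ≡⟨ cong (_+ ∑⋖ p g) (∑ₛ-const p _) ⟩
      ∣ p ∣ * pred ∣ p ∣ ! + ∑⋖ p g             ≤⟨ +-mono-≤ (n*pred[n]!≤n! ∣ p ∣) (g-super p ¬Bp) ⟩
      ∣ p ∣ ! + g p                             ∎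
      where
      open ≤-Reasoning
      IH : ∀ {x} → x ∈ₛ p → f (p - x) ≤ pred ∣ p ∣ ! + g (p - x)
      IH x∈p = subst (λ k → f (p - _) ≤ k ! + g (p - _)) (cong pred (x∈p⇒suc∣p-x∣≡∣p∣ x∈p))
                     (go (p - _) (rec (x∈p⇒∣p-x∣<∣p∣ x∈p)))

  ∣_∣! : Subset n → ℕ
  ∣ X ∣! = ∣ X ∣ !

  -- pairs (C, X) of a maximal chain C from ∅ to p and a member X of ℳ or 𝒜 lying on C (∣ X ∣! = chains ∅ X)
  incidences : List (Subset n) → List (Subset n) → Subset n → ℕ
  incidences ℳ 𝒜 p = chainsThrough ∣_∣! ℳ p + chainsThrough ∣_∣! 𝒜 p

  -- triples (C, A, M) with A ∈ 𝒜 and M ∈ ℳ both lying on the maximal chain C from ∅ to p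
  nestedIncidences : List (Subset n) → List (Subset n) → Subset n → ℕ
  nestedIncidences ℳ 𝒜 p = ∑ 𝒜 λ A → ∣ A ∣! * chainsThrough (chains A) ℳ p

  module _ {ℳ 𝒜 : List (Subset n)} {p : Subset n} where

    incidences-∑⋖ : p ∉ ℳ → p ∉ 𝒜 → ∑⋖ p (incidences ℳ 𝒜) ≡ incidences ℳ 𝒜 p
    incidences-∑⋖ p∉ℳ p∉𝒜 = trans (∑ₛ-distrib-+ p _ _)
                                   (cong₂ _+_ (chainsThrough-∑⋖ ∣_∣! p∉ℳ) (chainsThrough-∑⋖ ∣_∣! p∉𝒜))

    nestedIncidences-∑⋖ : p ∉ ℳ → ∑⋖ p (nestedIncidences ℳ 𝒜) ≡ nestedIncidences ℳ 𝒜 p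
    nestedIncidences-∑⋖ p∉ℳ =
      ∑⋖-∑ 𝒜 ∣_∣! (λ A → chainsThrough (chains A) ℳ) (λ {A} _ → chainsThrough-∑⋖ (chains A) p∉ℳ)

    incidences≤-∈ℳ : Unique ℳ → IsAntichain ℳ → p ∈ ℳ →
                     incidences ℳ 𝒜 p ≤ ∣ p ∣ ! + nestedIncidences ℳ 𝒜 p
    incidences≤-∈ℳ unique-ℳ antichain-ℳ p∈ℳ =
      +-mono-≤ (≤-reflexive (chainsThrough-antichain ∣_∣! unique-ℳ antichain-ℳ p∈ℳ))
               (∑-mono 𝒜 λ {A} _ → *-monoʳ-≤ ∣ A ∣! (≤-chainsThrough (chains A) p∈ℳ))

    incidences≤-∈𝒜 : IsAntichain ℳ → Unique 𝒜 → IsAntichain 𝒜 → ∀ {M′} → M′ ∈ ℳ → p ⊂ M′ → p ∈ 𝒜 →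
                     incidences ℳ 𝒜 p ≤ ∣ p ∣ ! + nestedIncidences ℳ 𝒜 p
    incidences≤-∈𝒜 antichain-ℳ unique-𝒜 antichain-𝒜 {M′} M′∈ℳ p⊂M′ p∈𝒜 = begin
      incidences ℳ 𝒜 p                  ≡⟨ cong₂ _+_ (chainsThrough-⊈ ∣_∣! no-M⊆p)
                                                     (chainsThrough-antichain ∣_∣! unique-𝒜 antichain-𝒜 p∈𝒜) ⟩
      ∣ p ∣ !                            ≤⟨ m≤m+n (∣ p ∣ !) _ ⟩
      ∣ p ∣ ! + nestedIncidences ℳ 𝒜 p  ∎
      where
      open ≤-Reasoning
      no-M⊆p : ∀ {M} → M ∈ ℳ → ¬ M ⊆ p
      no-M⊆p {M} M∈ℳ M⊆p = antichain-ℳ M M′ M∈ℳ M′∈ℳ (λ { refl → ⊂-irref refl M⊂M′ }) (p⊂q⇒p⊆q M⊂M′)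
        where M⊂M′ = ⊆-⊂-trans M⊆p p⊂M′

  incidences≤ : ∀ {ℳ 𝒜 : List (Subset n)} → Unique ℳ → Unique 𝒜 → IsAntichain ℳ → IsAntichain 𝒜 →
                (∀ {A} → A ∈ 𝒜 → ∃[ M ] M ∈ ℳ × A ⊂ M) →
                ∀ p → incidences ℳ 𝒜 p ≤ ∣ p ∣ ! + nestedIncidences ℳ 𝒜 p
  incidences≤ {ℳ = ℳ} {𝒜} unique-ℳ unique-𝒜 antichain-ℳ antichain-𝒜 covered =
    ≤!+-by-∑⋖-induction (λ p → p ∈? ℳ ⊎-dec p ∈? 𝒜) base
      (λ p p∉ → ≤-reflexive (sym (incidences-∑⋖ (p∉ ∘ inj₁) (p∉ ∘ inj₂))))
      (λ p p∉ → ≤-reflexive (nestedIncidences-∑⋖ {𝒜 = 𝒜} (p∉ ∘ inj₁)))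
    where
    open import Data.List.Membership.DecPropositional (≡-dec _≟ᵇ_) using (_∈?_)
    base : ∀ p → p ∈ ℳ ⊎ p ∈ 𝒜 → incidences ℳ 𝒜 p ≤ ∣ p ∣ ! + nestedIncidences ℳ 𝒜 p
    base p (inj₁ p∈ℳ) = incidences≤-∈ℳ {𝒜 = 𝒜} unique-ℳ antichain-ℳ p∈ℳ
    base p (inj₂ p∈𝒜) with M , M∈ℳ , p⊂M ← covered p∈𝒜 =
      incidences≤-∈𝒜 antichain-ℳ unique-𝒜 antichain-𝒜 M∈ℳ p⊂M p∈𝒜

  -- n! times the left-hand side: 1/C(n,m) = m! (n-m)!/n! and (1 - 1/(n-a))/C(n,a) = a! (n-a-1)! (n-a-1)/n!
  numerator : ∀ n → List (Subset n) → List (Subset n) → ℕ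
  numerator n ℳ 𝒜 = (∑ ℳ λ M → ∣ M ∣! * (n ∸ ∣ M ∣) !)
                   + (∑ 𝒜 λ A → ∣ A ∣! * pred (n ∸ ∣ A ∣) ! * pred (n ∸ ∣ A ∣))

  module TwoAntichains {n} {ℳ 𝒜 : List (Subset n)}
    (unique-ℳ : Unique ℳ) (unique-𝒜 : Unique 𝒜) (antichain-ℳ : IsAntichain ℳ) (antichain-𝒜 : IsAntichain 𝒜)
    (disjoint : ∀ X → X ∈ ℳ → X ∉ 𝒜) (⊤∉ℳ : ⊤ ∉ ℳ)
    (unique-above : ∀ A → A ∈ 𝒜 → Σ (Subset n) (λ M → M ∈ ℳ × A ⊂ M × (∀ M′ → M′ ∈ ℳ → A ⊂ M′ → M′ ≡ M)))
    where

    module _ {A} (A∈𝒜 : A ∈ 𝒜) where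

      f : Subset n
      f = proj₁ (unique-above A A∈𝒜)

      f∈ℳ : f ∈ ℳ
      f∈ℳ = proj₁ (proj₂ (unique-above A A∈𝒜))

      A⊂f : A ⊂ f
      A⊂f = proj₁ (proj₂ (proj₂ (unique-above A A∈𝒜)))

      f-unique : ∀ {M} → M ∈ ℳ → A ⊂ M → M ≡ f
      f-unique = proj₂ (proj₂ (proj₂ (unique-above A A∈𝒜))) _

      ∣A∣<∣f∣ : ∣ A ∣ < ∣ f ∣
      ∣A∣<∣f∣ = p⊂q⇒∣p∣<∣q∣ A⊂f

      ∣f∣<n : ∣ f ∣ < n
      ∣f∣<n = subst (∣ f ∣ <_) (∣⊤∣≡n n) (p⊂q⇒∣p∣<∣q∣ {p = f} {q = ⊤} (p⊆q∧p≢q⇒p⊂q ⊆⊤ f≢⊤))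
        where f≢⊤ = λ f≡⊤ → ⊤∉ℳ (subst (_∈ ℳ) f≡⊤ f∈ℳ)

      ∣A∣<n : ∣ A ∣ < n
      ∣A∣<n = <-trans ∣A∣<∣f∣ ∣f∣<n

      gaps : (∣ f ∣ ∸ ∣ A ∣) + (n ∸ ∣ f ∣) ≡ n ∸ ∣ A ∣
      gaps = [m∸l]+[n∸m]≡n∸l (<⇒≤ ∣A∣<∣f∣) (<⇒≤ ∣f∣<n)

      nested-⊤ : chainsThrough (chains A) ℳ ⊤ ≡ (∣ f ∣ ∸ ∣ A ∣) ! * (n ∸ ∣ f ∣) !
      nested-⊤ = begin
        chainsThrough (chains A) ℳ ⊤              ≡⟨ chainsThrough-⊤ (chains A) ℳ ⟩
        (∑ ℳ λ M → chains A M * (n ∸ ∣ M ∣) !)    ≡⟨ ∑-single _ unique-ℳ f∈ℳ others ⟩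
        chains A f * (n ∸ ∣ f ∣) !                 ≡⟨ cong (_* (n ∸ ∣ f ∣) !) (chains-⊆ {p = f} {A} (p⊂q⇒p⊆q A⊂f)) ⟩
        (∣ f ∣ ∸ ∣ A ∣) ! * (n ∸ ∣ f ∣) !          ∎
        where
        open ≡-Reasoning
        others : ∀ {M} → M ∈ ℳ → M ≢ f → chains A M * (n ∸ ∣ M ∣) ! ≡ 0
        others {M} M∈ℳ M≢f = cong (_* (n ∸ ∣ M ∣) !) (chains-⊈ λ A⊆M →
          M≢f (f-unique M∈ℳ (p⊆q∧p≢q⇒p⊂q A⊆M λ { refl → disjoint A M∈ℳ A∈𝒜 })))

      nested≤ : chainsThrough (chains A) ℳ ⊤ ≤ pred (n ∸ ∣ A ∣) !
      nested≤ = begin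
        chainsThrough (chains A) ℳ ⊤              ≡⟨ nested-⊤ ⟩
        (∣ f ∣ ∸ ∣ A ∣) ! * (n ∸ ∣ f ∣) !          ≤⟨ m!*n!≤pred[m+n]! _ _ {{∣f∣∸∣A∣≢0}} {{n∸∣f∣≢0}} ⟩
        pred ((∣ f ∣ ∸ ∣ A ∣) + (n ∸ ∣ f ∣)) !      ≡⟨ cong (λ m → pred m !) gaps ⟩
        pred (n ∸ ∣ A ∣) !                         ∎
        where
        open ≤-Reasoning
        ∣f∣∸∣A∣≢0 = >-nonZero (m<n⇒0<n∸m ∣A∣<∣f∣)
        n∸∣f∣≢0 = >-nonZero (m<n⇒0<n∸m ∣f∣<n)

      nested< : ∀ {M} → M ∈ ℳ → A ⊂ M → ∣ M ∣ ≢ n ∸ 1 → ∣ M ∣ ≢ ∣ A ∣ + 1 →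
                chainsThrough (chains A) ℳ ⊤ < pred (n ∸ ∣ A ∣) !
      nested< M∈ℳ A⊂M ∣M∣≢n∸1 ∣M∣≢∣A∣+1 with refl ← f-unique M∈ℳ A⊂M = begin-strict
        chainsThrough (chains A) ℳ ⊤              ≡⟨ nested-⊤ ⟩
        (∣ f ∣ ∸ ∣ A ∣) ! * (n ∸ ∣ f ∣) !          <⟨ m!*n!<pred[m+n]! _ _ 2≤∣f∣∸∣A∣ 2≤n∸∣f∣ ⟩
        pred ((∣ f ∣ ∸ ∣ A ∣) + (n ∸ ∣ f ∣)) !      ≡⟨ cong (λ m → pred m !) gaps ⟩
        pred (n ∸ ∣ A ∣) !                         ∎
        where
        open ≤-Reasoning
        2≤∣f∣∸∣A∣ : 2 ≤ ∣ f ∣ ∸ ∣ A ∣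
        2≤∣f∣∸∣A∣ = m+n≤o⇒m≤o∸n 2 (≤∧≢⇒< ∣A∣<∣f∣ λ 1+∣A∣≡∣f∣ → ∣M∣≢∣A∣+1 (trans (sym 1+∣A∣≡∣f∣) (+-comm 1 ∣ A ∣)))
        2≤n∸∣f∣ : 2 ≤ n ∸ ∣ f ∣
        2≤n∸∣f∣ = m+n≤o⇒m≤o∸n 2 (≤∧≢⇒< ∣f∣<n λ 1+∣f∣≡n → ∣M∣≢n∸1 (cong pred 1+∣f∣≡n))

    incidences-⊤ : incidences ℳ 𝒜 ⊤ ≡ numerator n ℳ 𝒜 + ∑ 𝒜 λ A → ∣ A ∣! * pred (n ∸ ∣ A ∣) !
    incidences-⊤ = begin
      incidences ℳ 𝒜 ⊤                ≡⟨ cong₂ _+_ (chainsThrough-⊤ ∣_∣! ℳ) (chainsThrough-⊤ ∣_∣! 𝒜) ⟩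
      ∑ ℳ c + ∑ 𝒜 (λ A → ∣ A ∣! * (n ∸ ∣ A ∣) !)
                                       ≡⟨ cong (∑ ℳ c +_) (∑-cong 𝒜 split) ⟩
      ∑ ℳ c + ∑ 𝒜 (λ A → e A + d A)   ≡⟨ cong (∑ ℳ c +_) (∑-distrib-+ 𝒜 e d) ⟩
      ∑ ℳ c + (∑ 𝒜 e + ∑ 𝒜 d)         ≡⟨ +-assoc (∑ ℳ c) _ _ ⟨
      numerator n ℳ 𝒜 + ∑ 𝒜 d          ∎
      where
      open ≡-Reasoning
      c d e : Subset n → ℕ
      c M = ∣ M ∣! * (n ∸ ∣ M ∣) !
      d A = ∣ A ∣! * pred (n ∸ ∣ A ∣) !
      e A = d A * pred (n ∸ ∣ A ∣)
      split : ∀ {A} → A ∈ 𝒜 → ∣ A ∣! * (n ∸ ∣ A ∣) ! ≡ e A + d A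
      split {A} A∈𝒜 = trans (cong (λ m → ∣ A ∣! * m !) (sym (suc-pred (n ∸ ∣ A ∣) {{n∸∣A∣≢0}})))
                            (x*[1+k]!≡x*k!*k+x*k! ∣ A ∣! (pred (n ∸ ∣ A ∣)))
        where n∸∣A∣≢0 = >-nonZero (m<n⇒0<n∸m (∣A∣<n A∈𝒜))

    nested≤-weighted : ∀ {A} → A ∈ 𝒜 → ∣ A ∣! * chainsThrough (chains A) ℳ ⊤ ≤ ∣ A ∣! * pred (n ∸ ∣ A ∣) !
    nested≤-weighted {A} A∈𝒜 = *-monoʳ-≤ ∣ A ∣! (nested≤ A∈𝒜)

    incidences≤-⊤ : numerator n ℳ 𝒜 + (∑ 𝒜 λ A → ∣ A ∣! * pred (n ∸ ∣ A ∣) !) ≤ n ! + nestedIncidences ℳ 𝒜 ⊤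
    incidences≤-⊤ = subst₂ _≤_ incidences-⊤ (cong (λ m → m ! + nestedIncidences ℳ 𝒜 ⊤) (∣⊤∣≡n n))
                      (incidences≤ unique-ℳ unique-𝒜 antichain-ℳ antichain-𝒜 covered ⊤)
      where
      covered : ∀ {A} → A ∈ 𝒜 → ∃[ M ] M ∈ ℳ × A ⊂ M
      covered A∈𝒜 = f A∈𝒜 , f∈ℳ A∈𝒜 , A⊂f A∈𝒜

    numerator≤n! : numerator n ℳ 𝒜 ≤ n !
    numerator≤n! = ∑-cancel-≤ nested≤-weighted incidences≤-⊤

    numerator<n! : ∀ {A M} → A ∈ 𝒜 → M ∈ ℳ → A ⊂ M → ∣ M ∣ ≢ n ∸ 1 → ∣ M ∣ ≢ ∣ A ∣ + 1 →
                   numerator n ℳ 𝒜 < n !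
    numerator<n! {A} A∈𝒜 M∈ℳ A⊂M ∣M∣≢n∸1 ∣M∣≢∣A∣+1 = ∑-cancel-< nested≤-weighted A∈𝒜 nested<-weighted incidences≤-⊤
      where
      nested<-weighted : ∣ A ∣! * chainsThrough (chains A) ℳ ⊤ < ∣ A ∣! * pred (n ∸ ∣ A ∣) !
      nested<-weighted = *-monoʳ-< ∣ A ∣! {{∣ A ∣ !≢0}} (nested< A∈𝒜 M∈ℳ A⊂M ∣M∣≢n∸1 ∣M∣≢∣A∣+1)


module Fractions where

  open import Defs using (inv; sumℚ)
  open import Data.Integer as ℤ using (+_; 1ℤ; -1ℤ)
  import Data.Integer.Properties as ℤ
  open import Data.Integer.Solver using (module +-*-Solver)
  open import Data.List using (List; []; _∷_; map)
  open import Data.List.Membership.Propositional using (_∈_)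
  open import Data.List.Relation.Unary.Any using (here; there)
  open import Data.Nat as ℕ using (ℕ; suc; pred; _∸_; _≤_; _<_; _!; NonZero)
  import Data.Nat.Properties as ℕ
  open import Data.Nat.Combinatorics using (_C_)
  import Data.Nat.Solver as ℕ-Solver
  open import Data.Rational using (ℚ; 0ℚ; 1ℚ; _+_; _*_; _-_; -_; toℚᵘ) renaming (_≤_ to _≤ℚ_)
  import Data.Rational.Properties as ℚ
  open import Data.Rational.Unnormalised as ℚᵘ using (mkℚᵘ; *≡*; *≤*; _≃_)
  import Data.Rational.Unnormalised.Properties as ℚᵘ
  open import Function using (_∘_)
  open import Relation.Binary.PropositionalEquality
  open Chains using (∑; nCk*[k!*[n∸k]!]≡n!)

  -- t ≈ c / N states t = c/N; comparing in ℚᵘ avoids normalising, so all terms can share the denominator N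
  infix 4 _≈_/_

  _≈_/_ : ℚ → ℕ → (N : ℕ) .{{_ : NonZero N}} → Set
  t ≈ c / N = toℚᵘ t ≃ (+ c ℚᵘ./ N)

  private
    +-* : ∀ m n → + m ℤ.* + n ≡ + (m ℕ.* n)
    +-* m n = sym (ℤ.pos-* m n)

  ≈-0 : ∀ {N} .{{_ : NonZero N}} → 0ℚ ≈ 0 / N
  ≈-0 {suc _} = *≡* refl

  ≈-+ : ∀ {N} .{{_ : NonZero N}} {t u a b} → t ≈ a / N → u ≈ b / N → t + u ≈ (a ℕ.+ b) / N
  ≈-+ {N@(suc _)} {t = t} {u} {a} {b} t≈a u≈b =
    ℚᵘ.≃-trans (ℚ.toℚᵘ-homo-+ t u) (ℚᵘ.≃-trans (ℚᵘ.+-cong t≈a u≈b) (*≡* same-denominator))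
    where
    open ≡-Reasoning
    open +-*-Solver
    same-denominator : (+ a ℤ.* + N ℤ.+ + b ℤ.* + N) ℤ.* + N ≡ + (a ℕ.+ b) ℤ.* + (N ℕ.* N)
    same-denominator = begin
      (+ a ℤ.* + N ℤ.+ + b ℤ.* + N) ℤ.* + N
        ≡⟨ solve 3 (λ a b n → (a :* n :+ b :* n) :* n := (a :+ b) :* (n :* n)) refl (+ a) (+ b) (+ N) ⟩
      (+ a ℤ.+ + b) ℤ.* (+ N ℤ.* + N)
        ≡⟨ cong₂ ℤ._*_ (ℤ.pos-+ a b) (+-* N N) ⟨
      + (a ℕ.+ b) ℤ.* + (N ℕ.* N)
        ∎

  sumℚ-≈ : ∀ {N} .{{_ : NonZero N}} {a} {A : Set a} (xs : List A) {f : A → ℚ} {c : A → ℕ} →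
           (∀ {x} → x ∈ xs → f x ≈ c x / N) → sumℚ (map f xs) ≈ ∑ xs c / N
  sumℚ-≈ []       f≈c = ≈-0
  sumℚ-≈ (x ∷ xs) f≈c = ≈-+ (f≈c (here refl)) (sumℚ-≈ xs (f≈c ∘ there))

  inv-≈ : ∀ {N} .{{_ : NonZero N}} d {c} → d ℕ.* c ≡ N → inv d ≈ c / N
  inv-≈ {N@(suc _)} d@(suc d-1) {c} d*c≡N = ℚᵘ.≃-trans (ℚ.toℚᵘ-fromℚᵘ (mkℚᵘ (+ 1) d-1)) (*≡* (begin
    + 1 ℤ.* + N       ≡⟨ ℤ.*-identityˡ (+ N) ⟩
    + N               ≡⟨ cong +_ d*c≡N ⟨
    + (d ℕ.* c)       ≡⟨ cong +_ (ℕ.*-comm d c) ⟩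
    + (c ℕ.* d)       ≡⟨ +-* c d ⟨
    + c ℤ.* + d       ∎))
    where open ≡-Reasoning

  1-1/[1+k]≃k/[1+k] : ∀ k → toℚᵘ (1ℚ - inv (suc k)) ≃ mkℚᵘ (+ k) k
  1-1/[1+k]≃k/[1+k] k = begin
    toℚᵘ (1ℚ - inv (suc k))                   ≈⟨ ℚ.toℚᵘ-homo-+ 1ℚ (- inv (suc k)) ⟩
    toℚᵘ 1ℚ ℚᵘ.+ toℚᵘ (- inv (suc k))         ≈⟨ ℚᵘ.+-congʳ (toℚᵘ 1ℚ) (ℚ.toℚᵘ-homo‿- (inv (suc k))) ⟩
    toℚᵘ 1ℚ ℚᵘ.- toℚᵘ (inv (suc k))           ≈⟨ ℚᵘ.+-congʳ (toℚᵘ 1ℚ) (ℚᵘ.-‿cong (ℚ.toℚᵘ-fromℚᵘ (mkℚᵘ (+ 1) k))) ⟩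
    mkℚᵘ (+ 1) 0 ℚᵘ.- mkℚᵘ (+ 1) k            ≈⟨ *≡* (solve 1 (λ k → (con 1ℤ :* (con 1ℤ :+ k) :+ con -1ℤ :* con 1ℤ)
                                                                    :* (con 1ℤ :+ k) := k :* (con 1ℤ :* (con 1ℤ :+ k)))
                                                         refl (+ k)) ⟩
    mkℚᵘ (+ k) k                              ∎
    where
    open ℚᵘ.≃-Reasoning
    open +-*-Solver

  c[1+k]/N*k/[1+k]≃ck/N : ∀ c k N-1 → mkℚᵘ (+ (c ℕ.* suc k)) N-1 ℚᵘ.* mkℚᵘ (+ k) k ≃ mkℚᵘ (+ (c ℕ.* k)) N-1
  c[1+k]/N*k/[1+k]≃ck/N c k N-1 = *≡* (begin
    + (c ℕ.* suc k) ℤ.* + k ℤ.* + N   ≡⟨ cong (ℤ._* + N) (+-* (c ℕ.* suc k) k) ⟩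
    + (c ℕ.* suc k ℕ.* k) ℤ.* + N     ≡⟨ +-* (c ℕ.* suc k ℕ.* k) N ⟩
    + (c ℕ.* suc k ℕ.* k ℕ.* N)       ≡⟨ cong +_ (solve 4 (λ c s k n → c :* s :* k :* n := c :* k :* (n :* s))
                                                        refl c (suc k) k N) ⟩
    + (c ℕ.* k ℕ.* (N ℕ.* suc k))     ≡⟨ +-* (c ℕ.* k) (N ℕ.* suc k) ⟨
    + (c ℕ.* k) ℤ.* + (N ℕ.* suc k)   ∎)
    where
    N = suc N-1
    open ≡-Reasoning
    open ℕ-Solver.+-*-Solver

  ≈-*-1-inv : ∀ {N} .{{_ : NonZero N}} {t c k} → t ≈ (c ℕ.* suc k) / N → t * (1ℚ - inv (suc k)) ≈ (c ℕ.* k) / N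
  ≈-*-1-inv {suc N-1} {t} {c} {k} t≈c[1+k] = begin
    toℚᵘ (t * (1ℚ - inv (suc k)))                     ≈⟨ ℚ.toℚᵘ-homo-* t (1ℚ - inv (suc k)) ⟩
    toℚᵘ t ℚᵘ.* toℚᵘ (1ℚ - inv (suc k))               ≈⟨ ℚᵘ.*-cong t≈c[1+k] (1-1/[1+k]≃k/[1+k] k) ⟩
    mkℚᵘ (+ (c ℕ.* suc k)) N-1 ℚᵘ.* mkℚᵘ (+ k) k      ≈⟨ c[1+k]/N*k/[1+k]≃ck/N c k N-1 ⟩
    mkℚᵘ (+ (c ℕ.* k)) N-1                             ∎
    where open ℚᵘ.≃-Reasoning

  ≈-≤-1 : ∀ {N} .{{_ : NonZero N}} {t c} → t ≈ c / N → c ≤ N → t ≤ℚ 1ℚ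
  ≈-≤-1 {N@(suc _)} {t} {c} t≈c c≤N = ℚ.toℚᵘ-cancel-≤ (ℚᵘ.≤-respˡ-≃ (ℚᵘ.≃-sym t≈c) (*≤* (begin
    + c ℤ.* + 1   ≡⟨ ℤ.*-identityʳ (+ c) ⟩
    + c           ≤⟨ ℤ.+≤+ c≤N ⟩
    + N           ≡⟨ ℤ.*-identityˡ (+ N) ⟨
    + 1 ℤ.* + N   ∎)))
    where open ℤ.≤-Reasoning

  ≈-1⇒≡ : ∀ {N} .{{_ : NonZero N}} {t c} → t ≈ c / N → t ≡ 1ℚ → c ≡ N
  ≈-1⇒≡ {suc _} {c = c} (*≡* 1*N≡c*1) refl =
    ℤ.+-injective (trans (sym (ℤ.*-identityʳ (+ c))) (trans (sym 1*N≡c*1) (ℤ.*-identityˡ _)))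

  module _ {n : ℕ} where

    private instance
      n!≢0 : NonZero (n !)
      n!≢0 = n ℕ.!≢0

    inv-nCk≈ : ∀ {k} → k ≤ n → inv (n C k) ≈ k ! ℕ.* (n ∸ k) ! / n !
    inv-nCk≈ {k} k≤n = inv-≈ (n C k) (nCk*[k!*[n∸k]!]≡n! k≤n)

    inv-nCk*[1-inv[n∸k]]≈ : ∀ {k} → k < n →
                            inv (n C k) * (1ℚ - inv (n ∸ k)) ≈ k ! ℕ.* pred (n ∸ k) ! ℕ.* pred (n ∸ k) / n !
    inv-nCk*[1-inv[n∸k]]≈ {k} k<n = subst (λ m → inv (n C k) * (1ℚ - inv m) ≈ k ! ℕ.* j ! ℕ.* j / n !) 1+j≡n∸k
      (≈-*-1-inv {c = k ! ℕ.* j !} {j} (inv-≈ (n C k) (trans (cong ((n C k) ℕ.*_) k!*j!*[1+j]≡k!*[n∸k]!)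
                                                             (nCk*[k!*[n∸k]!]≡n! (ℕ.<⇒≤ k<n)))))
      where
      j = pred (n ∸ k)
      1+j≡n∸k : suc j ≡ n ∸ k
      1+j≡n∸k = ℕ.suc-pred (n ∸ k) {{ℕ.>-nonZero (ℕ.m<n⇒0<n∸m k<n)}}
      k!*j!*[1+j]≡k!*[n∸k]! : k ! ℕ.* j ! ℕ.* suc j ≡ k ! ℕ.* (n ∸ k) !
      k!*j!*[1+j]≡k!*[n∸k]! = trans (ℕ.*-assoc (k !) (j !) (suc j))
                                    (cong (k ! ℕ.*_) (trans (ℕ.*-comm (j !) (suc j)) (cong _! 1+j≡n∸k)))

open import Defs
open import Data.Nat using (ℕ; _∸_; _!; _≟_; NonZero) renaming (_+_ to _+ℕ_)
open import Data.Nat.Combinatorics using (_C_)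
open import Data.Rational using (ℚ; 1ℚ; _+_; _*_; _-_) renaming (_≤_ to _≤ℚ_)
open import Data.List using (List; map)
open import Data.List.Membership.Propositional using (_∈_; _∉_)
open import Data.List.Relation.Unary.Unique.Propositional using (Unique)
open import Data.Fin.Subset using (Subset; _⊂_; ∣_∣; ⊤)
open import Data.Product using (Σ; _×_; _,_)
open import Data.Sum using (_⊎_; inj₁; inj₂)
open import Relation.Binary.PropositionalEquality using (_≡_)
open import Relation.Nullary using (yes; no; contradiction)
open import Data.Nat.Properties using (<⇒≢; _!≢0)
open import Data.Fin.Subset.Properties using (∣p∣≤n)
open Chains using (numerator; module TwoAntichains)
open Fractions

lemma3 : (n : ℕ) (ℳ 𝒜 : List (Subset n)) →
    Unique ℳ → Unique 𝒜 →
    IsAntichain ℳ → IsAntichain 𝒜 →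
    (∀ X → X ∈ ℳ → X ∉ 𝒜) →
    ⊤ ∉ ℳ →
    (∀ A → A ∈ 𝒜 → Σ (Subset n) (λ M → M ∈ ℳ × A ⊂ M × (∀ M′ → M′ ∈ ℳ → A ⊂ M′ → M′ ≡ M))) →
    let total = sumℚ (map (λ M → inv (n C ∣ M ∣)) ℳ) + sumℚ (map (λ A → inv (n C ∣ A ∣) * (1ℚ - inv (n ∸ ∣ A ∣))) 𝒜) in
    (total ≤ℚ 1ℚ) ×
    (total ≡ 1ℚ → ∀ A M → A ∈ 𝒜 → M ∈ ℳ → A ⊂ M → (∣ M ∣ ≡ n ∸ 1) ⊎ (∣ M ∣ ≡ ∣ A ∣ +ℕ 1))
lemma3 n ℳ 𝒜 unique-ℳ unique-𝒜 antichain-ℳ antichain-𝒜 disjoint ⊤∉ℳ unique-above =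
  ≈-≤-1 total≈ numerator≤n! , equality-case
  where
  open TwoAntichains unique-ℳ unique-𝒜 antichain-ℳ antichain-𝒜 disjoint ⊤∉ℳ unique-above

  instance
    n!≢0 : NonZero (n !)
    n!≢0 = n !≢0

  total : ℚ
  total = sumℚ (map (λ M → inv (n C ∣ M ∣)) ℳ) + sumℚ (map (λ A → inv (n C ∣ A ∣) * (1ℚ - inv (n ∸ ∣ A ∣))) 𝒜)

  total≈ : total ≈ numerator n ℳ 𝒜 / n !
  total≈ = ≈-+ (sumℚ-≈ ℳ λ {M} _ → inv-nCk≈ (∣p∣≤n M)) (sumℚ-≈ 𝒜 λ A∈𝒜 → inv-nCk*[1-inv[n∸k]]≈ (∣A∣<n A∈𝒜))

  equality-case : total ≡ 1ℚ → ∀ A M → A ∈ 𝒜 → M ∈ ℳ → A ⊂ M → (∣ M ∣ ≡ n ∸ 1) ⊎ (∣ M ∣ ≡ ∣ A ∣ +ℕ 1)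
  equality-case total≡1 A M A∈𝒜 M∈ℳ A⊂M with ∣ M ∣ ≟ n ∸ 1 | ∣ M ∣ ≟ ∣ A ∣ +ℕ 1
  ... | yes ∣M∣≡n∸1 | _               = inj₁ ∣M∣≡n∸1
  ... | no _        | yes ∣M∣≡∣A∣+1   = inj₂ ∣M∣≡∣A∣+1
  ... | no ∣M∣≢n∸1  | no ∣M∣≢∣A∣+1    =
    contradiction (≈-1⇒≡ total≈ total≡1) (<⇒≢ (numerator<n! A∈𝒜 M∈ℳ A⊂M ∣M∣≢n∸1 ∣M∣≢∣A∣+1))
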